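{- Let $\mathcal{H}$ be a hypergraph on vertex set $V=\{v_1,\dots,v_n\}$, let $i\in\{1,\dots,n-1\}$ and $T^\star\in Tr(\mathcal{H}_i)$. If $T\in \mathrm{children}(T^\star,i)$, then $T=T^\star\cup X$ for some $X\in Tr(\Delta_{i+1})$, where $\Delta_{i+1}=\{E\in E(\mathcal{H}_{i+1}) : E\cap T^\star=\emptyset\}$.
   Context: For a hypergraph $\mathcal{H}$ (finite vertex set, family of subsets called hyperedges), $Tr(\mathcal{H})$ denotes the set of inclusion-wise minimal transversals (sets meeting every hyperedge); the empty hypergraph has $\emptyset$ as its unique minimal transversal. For $0\le i\le n$ let $V_i=\{v_1,\dots,v_i\}$ and let $\mathcal{H}_i$ be the hypergraph with vertex set $V_i$ and hyperedges all $E\in E(\mathcal{H})$ with $E\subseteq V_i$. For $S\subseteq V_i$ and $v\in S$, $\mathrm{priv}_i(S,v)$ is the set of hyperedges $E$ of $\mathcal{H}_i$ with $E\cap S=\{v\}$. For $T\in Tr(\mathcal{H}_{i+1})$, $\mathrm{parent}(T,i+1)$ is the set obtained from $T$ by repeatedly removing, from the current set $S$, the vertex $v$ of smallest index with $\mathrm{priv}_i(S,v)=\emptyset$, until no such vertex exists. For $T^\star\in Tr(\mathcal{H}_i)$, $\mathrm{children}(T^\star,i)=\{T\in Tr(\mathcal{H}_{i+1}) : \mathrm{parent}(T,i+1)=T^\star\}$. -}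

module Defs where

open import Data.Nat using (ℕ; suc; _<_)
open import Data.Fin using (Fin; toℕ)
open import Data.Fin.Subset using (Subset; _∈_; _⊆_; _∩_; _∪_; _-_; ⁅_⁆; Empty)
open import Data.List using (List)
open import Data.List.Membership.Propositional using () renaming (_∈_ to _∈ₗ_)
open import Data.Product using (Σ; ∃; _×_)
open import Relation.Binary.PropositionalEquality using (_≡_)
open import Relation.Nullary using (¬_)

-- A hypergraph on vertex set {v_1,…,v_n}; vertex v_{k+1} is represented by
-- k : Fin n (so v_j has index j = toℕ k + 1).  Hyperedges form a finite
-- family (list) of subsets.
Hypergraph : ℕ → Set
Hypergraph n = List (Subset n)

EdgePred : ℕ → Set₁
EdgePred n = Subset n → Set

InV : ∀ {n} → ℕ → Subset n → Set
InV i S = ∀ k → k ∈ S → toℕ k < i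

EdgeOf : ∀ {n} → Hypergraph n → ℕ → EdgePred n
EdgeOf H i E = (E ∈ₗ H) × InV i E

IsTransversal : ∀ {n} → EdgePred n → Subset n → Set
IsTransversal Edge S = ∀ E → Edge E → ∃ λ v → v ∈ E × v ∈ S

IsMinTr : ∀ {n} → ℕ → EdgePred n → Subset n → Set
IsMinTr i Edge S =
  InV i S × IsTransversal Edge S ×
  (∀ S' → S' ⊆ S → InV i S' → IsTransversal Edge S' → S' ≡ S)

PrivEmpty : ∀ {n} → Hypergraph n → ℕ → Subset n → Fin n → Set
PrivEmpty H i S v = ¬ (∃ λ E → EdgeOf H i E × (E ∩ S) ≡ ⁅ v ⁆)

-- Reduces H i S R : the removal process defining parent(·, i+1), started
-- at S, terminates with R.
data Reduces {n} (H : Hypergraph n) (i : ℕ) : Subset n → Subset n → Set where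
  done : ∀ {S} → (∀ v → v ∈ S → ¬ PrivEmpty H i S v) → Reduces H i S S
  step : ∀ {S R} (v : Fin n) → v ∈ S → PrivEmpty H i S v →
         (∀ u → u ∈ S → toℕ u < toℕ v → ¬ PrivEmpty H i S u) →
         Reduces H i (S - v) R → Reduces H i S R

Parent : ∀ {n} → Hypergraph n → ℕ → Subset n → Subset n → Set
Parent H i T P = Reduces H i T P

IsChild : ∀ {n} → Hypergraph n → ℕ → Subset n → Subset n → Set
IsChild H i Tstar T = IsMinTr (suc i) (EdgeOf H (suc i)) T × Parent H i T Tstar

DeltaEdge : ∀ {n} → Hypergraph n → ℕ → Subset n → EdgePred n
DeltaEdge H i Tstar E = EdgeOf H (suc i) E × Empty (E ∩ Tstar)

{-# OPTIONS --safe #-}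
-- The parent process only deletes vertices, so T* ⊆ T and T = T* ∪ X with
-- X = T ∖ T*.  An edge of H_{i+1} disjoint from T* can only be hit by T inside
-- X, so X is a transversal of Δ_{i+1}.  If some S ⊆ X were already one, then
-- T* ∪ S would be a transversal of H_{i+1} inside T, hence equal to T by the
-- minimality of T, which forces S = X.
module Submission where

open import Defs
open import Data.Nat using (ℕ; suc; _≤_; _<_)
open import Data.Fin.Subset
  using (Subset; _∪_; _∩_; ∁; _∈_; _⊆_; ⁅_⁆; Empty)
open import Data.Fin.Subset.Properties
  using ( _∈?_; nonempty?; ⊆-antisym; p─q⊆p; x∈p∩q⁺; x∈p∩q⁻
        ; x∈p∪q⁺; x∈p∪q⁻; x∈∁p⇒x∉p; x∉p⇒x∈∁p)
open import Data.Product using (∃; _×_; _,_; proj₁; proj₂)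
open import Data.Sum using (inj₁; inj₂)
open import Relation.Binary.PropositionalEquality using (_≡_; subst; sym)
open import Relation.Nullary using (yes; no; contradiction)

private
  variable
    n : ℕ
    i : ℕ
    P S T : Subset n

Reduces⇒⊆ : {H : Hypergraph n} {R : Subset n} → Reduces H i S R → R ⊆ S
Reduces⇒⊆ (done _)           x∈R = x∈R
Reduces⇒⊆ (step v _ _ _ red) x∈R = p─q⊆p _ ⁅ v ⁆ (Reduces⇒⊆ red x∈R)

∪-lub : P ⊆ T → S ⊆ T → P ∪ S ⊆ T
∪-lub {P = P} {S = S} P⊆T S⊆T x∈P∪S with x∈p∪q⁻ P S x∈P∪S
... | inj₁ x∈P = P⊆T x∈P
... | inj₂ x∈S = S⊆T x∈S

p⊆q⇒q≡p∪[q∩∁p] : P ⊆ T → T ≡ P ∪ (T ∩ ∁ P)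
p⊆q⇒q≡p∪[q∩∁p] {P = P} {T = T} P⊆T =
  ⊆-antisym T⊆P∪[T∩∁P] (∪-lub P⊆T (λ {x} x∈T∩∁P → proj₁ (x∈p∩q⁻ T (∁ P) x∈T∩∁P)))
  where
  T⊆P∪[T∩∁P] : T ⊆ P ∪ (T ∩ ∁ P)
  T⊆P∪[T∩∁P] {x} x∈T with x ∈? P
  ... | yes x∈P = x∈p∪q⁺ (inj₁ x∈P)
  ... | no  x∉P = x∈p∪q⁺ (inj₂ (x∈p∩q⁺ (x∈T , x∉p⇒x∈∁p x∉P)))

InV-⊆ : S ⊆ T → InV i T → InV i S
InV-⊆ S⊆T T⊆Vᵢ k k∈S = T⊆Vᵢ k (S⊆T k∈S)

-- Δ_{i+1} is Avoiding (EdgeOf H (suc i)) T*.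
Avoiding : EdgePred n → Subset n → EdgePred n
Avoiding Edge P E = Edge E × Empty (E ∩ P)

IsTransversal-∩∁ : {Edge : EdgePred n} →
                   IsTransversal Edge T → IsTransversal (Avoiding Edge P) (T ∩ ∁ P)
IsTransversal-∩∁ {P = P} trT E (edge , E∩P≡∅) with trT E edge
... | v , v∈E , v∈T with v ∈? P
...   | yes v∈P = contradiction (v , x∈p∩q⁺ (v∈E , v∈P)) E∩P≡∅
...   | no  v∉P = v , v∈E , x∈p∩q⁺ (v∈T , x∉p⇒x∈∁p v∉P)

IsTransversal-∪ : {Edge : EdgePred n} →
                  IsTransversal (Avoiding Edge P) S → IsTransversal Edge (P ∪ S)
IsTransversal-∪ {P = P} trS E edge with nonempty? (E ∩ P)
... | yes (v , v∈E∩P) =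
  let v∈E , v∈P = x∈p∩q⁻ E P v∈E∩P in v , v∈E , x∈p∪q⁺ (inj₁ v∈P)
... | no E∩P≡∅ with trS E (edge , E∩P≡∅)
...   | v , v∈E , v∈S = v , v∈E , x∈p∪q⁺ (inj₂ v∈S)

IsMinTr-∩∁ : {Edge : EdgePred n} → P ⊆ T →
             IsMinTr i Edge T → IsMinTr i (Avoiding Edge P) (T ∩ ∁ P)
IsMinTr-∩∁ {P = P} {T = T} {i = i} {Edge = Edge} P⊆T (T⊆Vᵢ , trT , minT) =
  InV-⊆ X⊆T T⊆Vᵢ , IsTransversal-∩∁ trT , minX
  where
  X : Subset _
  X = T ∩ ∁ P

  X⊆T : X ⊆ T
  X⊆T {x} x∈X = proj₁ (x∈p∩q⁻ T (∁ P) x∈X)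

  minX : ∀ S → S ⊆ X → InV i S → IsTransversal (Avoiding Edge P) S → S ≡ X
  minX S S⊆X _ trS = ⊆-antisym S⊆X X⊆S
    where
    P∪S⊆T : P ∪ S ⊆ T
    P∪S⊆T = ∪-lub P⊆T (λ x∈S → X⊆T (S⊆X x∈S))

    P∪S≡T : P ∪ S ≡ T
    P∪S≡T = minT (P ∪ S) P∪S⊆T (InV-⊆ P∪S⊆T T⊆Vᵢ) (IsTransversal-∪ trS)

    X⊆S : X ⊆ S
    X⊆S {x} x∈X with x∈p∪q⁻ P S (subst (x ∈_) (sym P∪S≡T) (X⊆T x∈X))
    ... | inj₁ x∈P = contradiction x∈P (x∈∁p⇒x∉p (proj₂ (x∈p∩q⁻ T (∁ P) x∈X)))
    ... | inj₂ x∈S = x∈S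

lemma13 : ∀ (n : ℕ) (H : Hypergraph n) (i : ℕ) → 1 ≤ i → i < n →
          (Tstar : Subset n) → IsMinTr i (EdgeOf H i) Tstar →
          (T : Subset n) → IsChild H i Tstar T →
          ∃ λ X → IsMinTr (suc i) (DeltaEdge H i Tstar) X × T ≡ Tstar ∪ X
lemma13 n H i _ _ Tstar _ T (minT , parent) =
  T ∩ ∁ Tstar , IsMinTr-∩∁ Tstar⊆T minT , p⊆q⇒q≡p∪[q∩∁p] Tstar⊆T
  where
  Tstar⊆T : Tstar ⊆ T
  Tstar⊆T = Reduces⇒⊆ parent
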